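{- For every finite simple graph $G$ we have $A_b(G)\leq m_a(G)$.
   Context: A (proper) $k$-coloring of $G$ is a map $c:V(G)\to[k]$ with adjacent vertices colored differently, all $k$ colors used; $V_i=c^{ -1}(i)$. A coloring is acyclic if $G[V_i\cup V_j]$ is a forest for all $i,j$. A vertex $v$ is a b-vertex if the colors on $v$ and its neighbors are all $k$ colors. A recoloring step applied to $c$ and a color $i$ having no b-vertex recolors every $v\in V_i$ with a color not appearing on $v$ or its neighbors, producing a $(k-1)$-coloring; if both colorings are acyclic it is an acyclic recoloring step. $A_b(G)$ is the maximum number of colors of an acyclic coloring of $G$ to which no acyclic recoloring step can be applied. Acyclic degree: for $v\in V(G)$, a weak partition of $N_G(v)$ is a partition $P=\{A_0^P,A_1^P,\dots,A_k^P\}$ ($k\geq 0$) of $N_G(v)$ into disjoint sets with $|A_0^P|\geq 0$ (possibly empty) and $|A_t^P|\geq 2$ for $t\in[k]$; let $\mathcal{P}(v)$ be the family of all of them, so $|P|-1=k$. Paths of even length (odd number of vertices) $x_1x_2\cdots x_{2r+1}$ are called even-vertex internally (EVI) disjoint if no vertex lies in an even position ($x_2,x_4,\dots,x_{2r}$) of two different such paths (they may share vertices in odd positions). ${\rm elp}_G(v,P)$ is the maximum number of pairwise EVI disjoint paths not containing $v$, each of even length with its two (distinct) end vertices both in the same set $A_t^P$ for some $t\in[k]$. The acyclic degree is $d_G^a(v)=\max_{P\in\mathcal{P}(v)}\big(|A_0^P|+(|P|-1)+{\rm elp}_G(v,P)\big)$. Ordering the vertices $v_1,\dots,v_{n_G}$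 of $G$ by non-increasing acyclic degree, $m_a(G)=\max\{i: d_G^a(v_i)\geq i-1\}$. -}

module Defs where

open import Data.Nat using (ℕ; zero; suc; _+_; _*_; _≤_; _≤ᵇ_; _⊔_)
open import Data.Bool using (Bool; true; false; _∧_; if_then_else_)
open import Data.Fin using (Fin; zero; suc; toℕ; fromℕ; inject₁; punchOut; punchIn)
import Data.Fin as F
open import Data.List using (List; foldr; map; allFin)
open import Data.Product using (Σ; ∃; _×_; _,_)
open import Data.Sum using (_⊎_)
open import Data.Empty using (⊥)
open import Relation.Nullary using (¬_)
open import Relation.Binary.PropositionalEquality using (_≡_; _≢_)
open import Function.Definitions using (Injective)

record Graph (n : ℕ) : Set where
  field
    E     : Fin n → Fin n → Bool
    sym   : ∀ u v → E u v ≡ E v u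
    irref : ∀ v → E v v ≡ false

module _ {n : ℕ} (G : Graph n) where
  open Graph G

  Adj : Fin n → Fin n → Set
  Adj u v = E u v ≡ true

  IsColoring : ∀ {k} → (Fin n → Fin k) → Set
  IsColoring {k} c = (∀ u w → Adj u w → c u ≢ c w) × (∀ (i : Fin k) → ∃ λ v → c v ≡ i)

  record CycleIn (S : Fin n → Set) : Set where
    field
      m     : ℕ
      x     : Fin (3 + m) → Fin n
      inj   : Injective _≡_ _≡_ x
      step  : ∀ (j : Fin (2 + m)) → Adj (x (inject₁ j)) (x (suc j))
      close : Adj (x (fromℕ (2 + m))) (x zero)
      inS   : ∀ j → S (x j)

  Forest : (Fin n → Set) → Set
  Forest S = ¬ CycleIn S

  IsAcyclic : ∀ {k} → (Fin n → Fin k) → Set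
  IsAcyclic {k} c = ∀ (i j : Fin k) → Forest (λ v → c v ≡ i ⊎ c v ≡ j)

  IsAcyclicColoring : ∀ {k} → (Fin n → Fin k) → Set
  IsAcyclicColoring c = IsColoring c × IsAcyclic c

  IsBVertex : ∀ {k} → (Fin n → Fin k) → Fin n → Set
  IsBVertex {k} c v = ∀ (j : Fin k) → c v ≡ j ⊎ ∃ λ u → Adj v u × c u ≡ j

  -- Colours other than i are renumbered
  -- order-preservingly onto Fin k (punchOut / punchIn i).
  RecoloringStep : ∀ {k} → (Fin n → Fin (suc k)) → Fin (suc k) → (Fin n → Fin k) → Set
  RecoloringStep c i c' =
      (∀ v → c v ≡ i → ¬ IsBVertex c v)
    × (∀ v (h : i ≢ c v) → c' v ≡ punchOut h)
    × (∀ v → c v ≡ i → punchIn i (c' v) ≢ c v × (∀ u → Adj v u → punchIn i (c' v) ≢ c u))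
    × IsColoring c'

  AcyclicRecoloringStep : ∀ {k} → (Fin n → Fin (suc k)) → Fin (suc k) → (Fin n → Fin k) → Set
  AcyclicRecoloringStep c i c' = IsAcyclicColoring c × RecoloringStep c i c' × IsAcyclicColoring c'

  CanAcyclicStep : ∀ {k} → (Fin n → Fin k) → Set
  CanAcyclicStep {zero}  c = ⊥
  CanAcyclicStep {suc k} c = ∃ λ i → ∃ λ (c' : Fin n → Fin k) → AcyclicRecoloringStep c i c'

  countB : (Fin n → Bool) → ℕ
  countB p = foldr (λ u acc → if p u then suc acc else acc) 0 (allFin n)

  isZero : ∀ {k} → Fin (suc k) → Bool
  isZero zero    = true
  isZero (suc _) = false

  -- weak partition P = {A_0, A_1, ..., A_k} of N(v):
  -- A_t = { u ∈ N(v) : part u ≡ t }  (labels of non-neighbours are irrelevant)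
  record WeakPartition (v : Fin n) : Set where
    field
      k     : ℕ
      part  : Fin n → Fin (suc k)
      big   : ∀ (t : Fin k) → ∃ λ u → ∃ λ w → u ≢ w
                × Adj v u × part u ≡ suc t × Adj v w × part w ≡ suc t

  sizeA0 : ∀ {v} → WeakPartition v → ℕ
  sizeA0 {v} P = countB (λ u → E v u ∧ isZero (WeakPartition.part P u))

  record EvenPath (v : Fin n) (P : WeakPartition v) : Set where
    field
      r     : ℕ
      x     : Fin (3 + 2 * r) → Fin n
      inj   : Injective _≡_ _≡_ x
      step  : ∀ (j : Fin (2 + 2 * r)) → Adj (x (inject₁ j)) (x (suc j))
      avoid : ∀ j → x j ≢ v
      t     : Fin (WeakPartition.k P)
      first : Adj v (x zero) × WeakPartition.part P (x zero) ≡ suc t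
      last  : Adj v (x (fromℕ (2 + 2 * r)))
              × WeakPartition.part P (x (fromℕ (2 + 2 * r))) ≡ suc t

  -- u occupies an even position x_2, x_4, … (1-indexed), i.e. an odd 0-based index
  AtEvenPos : ∀ {v P} → EvenPath v P → Fin n → Set
  AtEvenPos p u = ∃ λ j → (∃ λ q → toℕ j ≡ suc (2 * q)) × EvenPath.x p j ≡ u

  EVIFamily : (v : Fin n) → WeakPartition v → ℕ → Set
  EVIFamily v P m = Σ (Fin m → EvenPath v P) λ ps →
    ∀ a b → a ≢ b → ∀ u → AtEvenPos (ps a) u → ¬ AtEvenPos (ps b) u

  -- d^a_G(v) = max_P ( |A_0| + (|P|-1) + elp(v,P) ),
  -- elp(v,P) = max size of an EVI disjoint family
  -- (unfolded: maximum over pairs (P, family) of |A_0| + k + m)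
  IsElp : (v : Fin n) → WeakPartition v → ℕ → Set
  IsElp v P e = EVIFamily v P e × (∀ m → EVIFamily v P m → m ≤ e)

  IsAcyclicDegree : Fin n → ℕ → Set
  IsAcyclicDegree v d =
      (∃ λ (P : WeakPartition v) → ∃ λ e → IsElp v P e × sizeA0 P + WeakPartition.k P + e ≡ d)
    × (∀ (P : WeakPartition v) e → IsElp v P e → sizeA0 P + WeakPartition.k P + e ≤ d)

-- m_a from a listing f(0), f(1), … of the acyclic degrees of v_1, v_2, …
-- (0-based index j corresponds to v_{j+1}):  max { i : f(i-1) ≥ i-1 }  (0 if n = 0)

maFromList : ∀ {n} → (Fin n → ℕ) → ℕ
maFromList {n} f = foldr _⊔_ 0
  (map (λ j → if toℕ j ≤ᵇ f j then suc (toℕ j) else 0) (allFin n))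

NonIncreasing : ∀ {n} → (Fin n → ℕ) → Set
NonIncreasing f = ∀ i j → i F.≤ j → f j ≤ f i

-- Fix a colour i and suppose every vertex of colour i has acyclic degree below k - 1. Recolour the
-- vertices of colour i one at a time, each with a colour missing around it that keeps the colouring
-- acyclic. If this never gets stuck, it performs an acyclic recoloring step, which is excluded. So it
-- gets stuck at some u: every colour j missing around u closes a cycle in colours j and l through u,
-- i.e. an even path between two neighbours of u of colour l whose even-position vertices have colour
-- j, and the paths for different j are EVI disjoint. Partition N(u) by colour, the colours occurring
-- at least twice on N(u) forming A_1, ..., A_t. The k colours are i, the missing ones (at most elp),
-- those occurring once (at most |A_0|) and those occurring at least twice (t of them), so
-- k - 1 <= d^a(u), a contradiction. Hence every colour carries a vertex of acyclic degree at least
-- k - 1, so the k-th largest acyclic degree is at least k - 1, that is m_a >= k.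

{-# OPTIONS --safe #-}
module Submission where

open import Defs
open import Data.Nat using (NonZero; ℕ; zero; suc; _+_; _*_; _≤_; _<_; z≤n; s≤s; s≤s⁻¹; _≤ᵇ_; _≡ᵇ_; _⊔_; _≤?_)
open import Data.Nat.Properties hiding (_≟_)
open import Data.Nat.DivMod using (_%_; _/_; /-monoˡ-≤; m%n<n; m<n⇒m%n≡m; [m+n]%n≡m%n; %-distribˡ-+; n%n≡0; m≡m%n+[m/n]*n)
open import Data.Bool using (Bool; true; false; T; T?; _∧_; _∨_; not; if_then_else_)
open import Data.Bool.Properties using (T-≡; T-∧)
open import Data.Fin using (Fin; zero; suc; toℕ; fromℕ; fromℕ<; inject₁; punchIn; punchOut)
open import Data.Fin.Properties
  using (toℕ-injective; toℕ-fromℕ<; toℕ-fromℕ; toℕ-inject₁; toℕ<n; injective⇒≤; any?; _≟_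
        ; punchOut-cong; punchOut-injective; punchIn-punchOut; punchOut-punchIn; punchInᵢ≢i)
  renaming (suc-injective to Fin-suc-injective)
open import Data.List using (List; []; _∷_; foldr; tabulate; allFin)
open import Data.List.Membership.Propositional using (_∈_)
open import Data.List.Membership.Propositional.Properties using (∈-allFin; ∈-map⁺)
open import Data.List.Relation.Unary.Any using (here; there)
open import Data.Product using (∃; ∃₂; _×_; _,_; proj₁; proj₂)
open import Data.Sum using (_⊎_; inj₁; inj₂)
open import Data.Empty using (⊥)
open import Data.Vec.Functional using (updateAt)
open import Data.Vec.Functional.Properties using (updateAt-updates; updateAt-minimal)
open import Function using (_∘_; id; const; Equivalence)
open import Function.Definitions using (Injective)
open import Relation.Nullary using (¬_; Dec; yes; no; contradiction; _×-dec_)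
open import Relation.Nullary.Decidable using (⌊_⌋; toWitness; fromWitness; toWitnessFalse; decidable-stable)
open import Relation.Nullary.Negation using (¬¬-map)
open import Relation.Nullary.Decidable.Core using (¬¬-excluded-middle)
open import Relation.Binary.PropositionalEquality

count : ∀ {N} → (Fin N → Bool) → ℕ
count {zero}  p = 0
count {suc N} p = if p zero then suc (count (p ∘ suc)) else count (p ∘ suc)

record Enumeration {N} (p : Fin N → Bool) (m : ℕ) : Set where
  field
    at           : Fin m → Fin N
    at-injective : Injective _≡_ _≡_ at
    at-holds     : ∀ t → T (p (at t))
    index        : ∀ x → T (p x) → Fin m
    at-index     : ∀ x (px : T (p x)) → at (index x px) ≡ x

enumerate : ∀ {N} (p : Fin N → Bool) → Enumeration p (count p)
enumerate {zero}  p = record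
  { at = λ () ; at-injective = λ { {()} } ; at-holds = λ () ; index = λ () ; at-index = λ () }
enumerate {suc N} p = extend (p zero) refl (enumerate (p ∘ suc))
  where
  -- count p only unfolds once p zero is known, hence the abstraction over it.
  extend : ∀ {m} b → p zero ≡ b → Enumeration (p ∘ suc) m → Enumeration p (if b then suc m else m)
  extend {m} true p₀ E = record
    { at = at′ ; at-injective = at′-injective ; at-holds = at′-holds ; index = index′ ; at-index = at′-index′ }
    where
    open Enumeration E
    at′ : Fin (suc m) → Fin (suc N)
    at′ zero    = zero
    at′ (suc t) = suc (at t)
    at′-injective : Injective _≡_ _≡_ at′
    at′-injective {zero}  {zero}  _ = refl
    at′-injective {suc s} {suc t} e = cong suc (at-injective (Fin-suc-injective e))
    at′-injective {zero}  {suc _} ()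
    at′-injective {suc _} {zero}  ()
    at′-holds : ∀ t → T (p (at′ t))
    at′-holds zero    = Equivalence.from T-≡ p₀
    at′-holds (suc t) = at-holds t
    index′ : ∀ x → T (p x) → Fin (suc m)
    index′ zero    _  = zero
    index′ (suc x) px = suc (index x px)
    at′-index′ : ∀ x (px : T (p x)) → at′ (index′ x px) ≡ x
    at′-index′ zero    _  = refl
    at′-index′ (suc x) px = cong suc (at-index x px)
  extend {m} false p₀ E = record
    { at = suc ∘ at ; at-injective = at-injective ∘ Fin-suc-injective ; at-holds = at-holds
    ; index = index′ ; at-index = at′-index′ }
    where
    open Enumeration E
    ¬p₀ : ¬ T (p zero)
    ¬p₀ pz with () ← trans (sym p₀) (Equivalence.to T-≡ pz)
    index′ : ∀ x → T (p x) → Fin m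
    index′ zero    px = contradiction px ¬p₀
    index′ (suc x) px = index x px
    at′-index′ : ∀ x (px : T (p x)) → suc (at (index′ x px)) ≡ x
    at′-index′ zero    px = contradiction px ¬p₀
    at′-index′ (suc x) px = cong suc (at-index x px)

module _ {N} (p : Fin N → Bool) where
  open Enumeration (enumerate p)

  injection⇒≤count : ∀ {M} (g : Fin M → Fin N) → Injective _≡_ _≡_ g → (∀ t → T (p (g t))) → M ≤ count p
  injection⇒≤count g g-injective g-holds = injective⇒≤ {f = λ t → index (g t) (g-holds t)} λ {s} {t} e →
    g-injective (trans (sym (at-index _ (g-holds s))) (trans (cong at e) (at-index _ (g-holds t))))

  holds⇒1≤count : ∀ {x} → T (p x) → 1 ≤ count p
  holds⇒1≤count {x} px = injection⇒≤count (const x) (λ { {zero} {zero} _ → refl }) (const px)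

  unique⇒count≤1 : (∀ {x y} → T (p x) → T (p y) → x ≡ y) → count p ≤ 1
  unique⇒count≤1 unique = injective⇒≤ {f = const (zero {0})} λ {s} {t} _ →
    at-injective (unique (at-holds s) (at-holds t))

  1≤count⇒holds : 1 ≤ count p → ∃ λ x → T (p x)
  1≤count⇒holds 1≤ = at (fromℕ< 1≤) , at-holds _

  2≤count⇒holds₂ : 2 ≤ count p → ∃₂ λ x y → x ≢ y × T (p x) × T (p y)
  2≤count⇒holds₂ 2≤ = at first , at second , first≢second ∘ at-injective , at-holds _ , at-holds _
    where
    first second : Fin (count p)
    first  = fromℕ< (≤-trans (s≤s z≤n) 2≤)
    second = fromℕ< 2≤
    first≢second : first ≢ second
    first≢second e = 0≢1+n (trans (sym (toℕ-fromℕ< _)) (trans (cong toℕ e) (toℕ-fromℕ< _)))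

count-∨ : ∀ {N} (p q : Fin N → Bool) → count (λ x → p x ∨ q x) ≤ count p + count q
count-∨ {zero}  p q = z≤n
count-∨ {suc N} p q = step (p zero) (q zero) (count-∨ (p ∘ suc) (q ∘ suc))
  where
  step : ∀ a b {x y z} → z ≤ x + y →
         (if a ∨ b then suc z else z) ≤ (if a then suc x else x) + (if b then suc y else y)
  step true  true  {x} {y} z≤ = s≤s (≤-trans z≤ (+-monoʳ-≤ x (n≤1+n y)))
  step true  false z≤ = s≤s z≤
  step false true  {x} {y} z≤ = ≤-trans (s≤s z≤) (≤-reflexive (sym (+-suc x y)))
  step false false z≤ = z≤

foldr-count-tabulate : ∀ {n N} (p : Fin n → Bool) (f : Fin N → Fin n) →
  foldr (λ u acc → if p u then suc acc else acc) 0 (tabulate f) ≡ count (p ∘ f)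
foldr-count-tabulate {N = zero}  p f = refl
foldr-count-tabulate {N = suc N} p f =
  cong (λ a → if p (f zero) then suc a else a) (foldr-count-tabulate p (f ∘ suc))

∈-tail : ∀ {A : Set} {x y : A} {ys} → x ∈ y ∷ ys → x ≢ y → x ∈ ys
∈-tail (here x≡y)   x≢y = contradiction x≡y x≢y
∈-tail (there x∈ys) _   = x∈ys

¬¬-Π-Fin : ∀ {M} {B : Fin M → Set} → (∀ t → ¬ ¬ B t) → ¬ ¬ (∀ t → B t)
¬¬-Π-Fin {zero}      _  k = k λ ()
¬¬-Π-Fin {suc M} {B} hs k = hs zero λ b₀ → ¬¬-Π-Fin {B = B ∘ suc} (hs ∘ suc) λ bs →
  k λ { zero → b₀ ; (suc t) → bs t }

¬¬-bounded-maximum : ∀ (Q : ℕ → Set) {B} → (∀ m → Q m → m ≤ B) → ∀ {m} → Q m →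
                     ¬ ¬ (∃ λ e → Q e × ∀ m → Q m → m ≤ e)
¬¬-bounded-maximum Q {B} bounded {m} qm = search B (m≤m+n B m) qm
  where
  search : ∀ d {m} → B ≤ d + m → Q m → ¬ ¬ (∃ λ e → Q e × ∀ m → Q m → m ≤ e)
  search zero    {m} B≤m  qm k = k (m , qm , λ m′ qm′ → ≤-trans (bounded m′ qm′) B≤m)
  search (suc d) {m} B≤1+d+m qm k = ¬¬-excluded-middle {A = ∃ λ m′ → Q m′ × m < m′} λ
    { (yes (m′ , qm′ , m<m′)) →
        search d (≤-trans B≤1+d+m (≤-trans (≤-reflexive (sym (+-suc d m))) (+-monoʳ-≤ d m<m′))) qm′ k
    ; (no ¬bigger) → k (m , qm , λ m′ qm′ → ≮⇒≥ λ m<m′ → ¬bigger (m′ , qm′ , m<m′)) }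

module _ {n} (G : Graph n) where

  Adj-sym : ∀ {u w} → Adj G u w → Adj G w u
  Adj-sym {u} {w} uw = trans (Graph.sym G w u) uw

  Adj-irrefl : ∀ {u w} → Adj G u w → u ≢ w
  Adj-irrefl {u} uu refl with () ← trans (sym uu) (Graph.irref G u)

  IsProper : ∀ {k} → (Fin n → Fin k) → Set
  IsProper col = ∀ u w → Adj G u w → col u ≢ col w

  CycleIn-transport : ∀ {S T} (C : CycleIn G S) → (∀ j → T (CycleIn.x C j)) → CycleIn G T
  CycleIn-transport C T-x = record { CycleIn C ; inS = T-x }

-- Bichromatic cycles

even⊎odd : ∀ m → (∃ λ h → m ≡ 2 * h) ⊎ (∃ λ h → m ≡ suc (2 * h))
even⊎odd zero    = inj₁ (0 , refl)
even⊎odd (suc m) with even⊎odd m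
... | inj₁ (h , m≡2h)   = inj₂ (h , cong suc m≡2h)
... | inj₂ (h , m≡1+2h) = inj₁ (suc h , trans (cong suc m≡1+2h) (sym (*-suc 2 h)))

%-injective-window : ∀ L .{{_ : NonZero L}} {a b} → a ≤ b → b < a + L → a % L ≡ b % L → a ≡ b
%-injective-window L {a} {b} a≤b b<a+L a≡b = begin-equality
  a                 ≡⟨ m≡m%n+[m/n]*n a L ⟩
  a % L + a / L * L ≡⟨ cong₂ (λ r q → r + q * L) a≡b (≤-antisym (/-monoˡ-≤ L a≤b) b/L≤a/L) ⟩
  b % L + b / L * L ≡⟨ m≡m%n+[m/n]*n b L ⟨
  b                 ∎
  where
  open ≤-Reasoning
  b/L≤a/L : b / L ≤ a / L
  b/L≤a/L = s≤s⁻¹ (*-cancelʳ-< L (b / L) (suc (a / L)) (+-cancelˡ-< (b % L) _ _ (begin-strict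
    b % L + b / L * L     ≡⟨ m≡m%n+[m/n]*n b L ⟨
    b                     <⟨ b<a+L ⟩
    a + L                 ≡⟨ cong (_+ L) (m≡m%n+[m/n]*n a L) ⟩
    a % L + a / L * L + L ≡⟨ +-assoc (a % L) _ L ⟩
    a % L + (a / L * L + L) ≡⟨ cong₂ _+_ a≡b (+-comm _ L) ⟩
    b % L + suc (a / L) * L ∎)))

module ClosedWalk {n} {G : Graph n} {S : Fin n → Set} (C : CycleIn G S) (p : Fin (3 + CycleIn.m C)) where
  open CycleIn C

  L : ℕ
  L = 3 + m

  position : ℕ → Fin L
  position q = fromℕ< (m%n<n (toℕ p + q) L)

  walk : ℕ → Fin n
  walk = x ∘ position

  toℕ-position : ∀ q → toℕ (position q) ≡ (toℕ p + q) % L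
  toℕ-position q = toℕ-fromℕ< _

  walk-cong : ∀ {a b} → (toℕ p + a) % L ≡ (toℕ p + b) % L → walk a ≡ walk b
  walk-cong {a} {b} e = cong x (toℕ-injective (trans (toℕ-position a) (trans e (sym (toℕ-position b)))))

  walk-mod : ∀ {a b} → walk a ≡ walk b → (toℕ p + a) % L ≡ (toℕ p + b) % L
  walk-mod {a} {b} e = trans (sym (toℕ-position a)) (trans (cong toℕ (inj e)) (toℕ-position b))

  walk-start : walk 0 ≡ x p
  walk-start = cong x (toℕ-injective (begin
    toℕ (position 0)  ≡⟨ toℕ-position 0 ⟩
    (toℕ p + 0) % L   ≡⟨ cong (_% L) (+-identityʳ (toℕ p)) ⟩
    toℕ p % L         ≡⟨ m<n⇒m%n≡m (toℕ<n p) ⟩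
    toℕ p             ∎))
    where open ≡-Reasoning

  walk-periodic : walk L ≡ walk 0
  walk-periodic = walk-cong (trans ([m+n]%n≡m%n (toℕ p) L) (cong (_% L) (sym (+-identityʳ (toℕ p)))))

  walk-in : ∀ q → S (walk q)
  walk-in q = inS (position q)

  walk-injective-≤ : ∀ {a b} → a ≤ b → b < L → walk a ≡ walk b → a ≡ b
  walk-injective-≤ {a} {b} a≤b b<L e = +-cancelˡ-≡ (toℕ p) a b (%-injective-window L
    (+-monoʳ-≤ (toℕ p) a≤b)
    (<-≤-trans (+-monoʳ-< (toℕ p) (<-≤-trans b<L (m≤n+m L a))) (≤-reflexive (sym (+-assoc (toℕ p) a L))))
    (walk-mod e))

  walk-injective : ∀ {a b} → a < L → b < L → walk a ≡ walk b → a ≡ b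
  walk-injective {a} {b} a<L b<L e with ≤-total a b
  ... | inj₁ a≤b = walk-injective-≤ a≤b b<L e
  ... | inj₂ b≤a = sym (walk-injective-≤ b≤a a<L (sym e))

  walk-at : ∀ q (f : Fin L) → (toℕ p + q) % L ≡ toℕ f → walk q ≡ x f
  walk-at q f e = cong x (toℕ-injective (trans (toℕ-position q) e))

  next-mod : ∀ q → (toℕ p + suc q) % L ≡ suc ((toℕ p + q) % L) % L
  next-mod q = begin
    (toℕ p + suc q) % L           ≡⟨ cong (_% L) (+-suc (toℕ p) q) ⟩
    (1 + (toℕ p + q)) % L         ≡⟨ %-distribˡ-+ 1 (toℕ p + q) L ⟩
    (1 % L + (toℕ p + q) % L) % L ≡⟨ cong (λ o → (o + (toℕ p + q) % L) % L) (m<n⇒m%n≡m {n = L} (s≤s (s≤s z≤n))) ⟩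
    suc ((toℕ p + q) % L) % L     ∎
    where open ≡-Reasoning

  walk-adj : ∀ q → Adj G (walk q) (walk (suc q))
  walk-adj q with m≤n⇒m<n∨m≡n (s≤s⁻¹ (m%n<n (toℕ p + q) L))
  ... | inj₁ r<2+m = subst₂ (Adj G)
    (sym (walk-at q _ (sym (trans (toℕ-inject₁ _) (toℕ-fromℕ< r<2+m)))))
    (sym (walk-at (suc q) _ (trans (next-mod q) (trans (m<n⇒m%n≡m (s≤s r<2+m)) (cong suc (sym (toℕ-fromℕ< r<2+m)))))))
    (step (fromℕ< r<2+m))
  ... | inj₂ r≡2+m = subst₂ (Adj G)
    (sym (walk-at q _ (trans r≡2+m (sym (toℕ-fromℕ (2 + m))))))
    (sym (walk-at (suc q) zero (trans (next-mod q) (trans (cong (λ r → suc r % L) r≡2+m) (n%n≡0 L)))))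
    close

record AlternatingPath {n} (G : Graph n) {k} (col : Fin n → Fin k) (u : Fin n) : Set where
  field
    r           : ℕ
    x           : Fin (3 + 2 * r) → Fin n
    inj         : Injective _≡_ _≡_ x
    step        : ∀ (j : Fin (2 + 2 * r)) → Adj G (x (inject₁ j)) (x (suc j))
    avoid       : ∀ j → x j ≢ u
    first-adj   : Adj G u (x zero)
    last-adj    : Adj G u (x (fromℕ (2 + 2 * r)))
    ends-colour : col (x zero) ≡ col (x (fromℕ (2 + 2 * r)))
    odd-colour  : ∀ j q → toℕ j ≡ suc (2 * q) → col (x j) ≡ col u

≢-≢⇒≡-in-pair : ∀ {A : Set} {a b s₁ s₂ s₃ : A} →
  s₁ ≡ a ⊎ s₁ ≡ b → s₂ ≡ a ⊎ s₂ ≡ b → s₃ ≡ a ⊎ s₃ ≡ b → s₁ ≢ s₂ → s₂ ≢ s₃ → s₁ ≡ s₃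
≢-≢⇒≡-in-pair (inj₁ refl) (inj₁ refl) _           s₁≢s₂ _     = contradiction refl s₁≢s₂
≢-≢⇒≡-in-pair (inj₁ refl) (inj₂ refl) (inj₁ refl) _     _     = refl
≢-≢⇒≡-in-pair (inj₁ refl) (inj₂ refl) (inj₂ refl) _     s₂≢s₃ = contradiction refl s₂≢s₃
≢-≢⇒≡-in-pair (inj₂ refl) (inj₁ refl) (inj₁ refl) _     s₂≢s₃ = contradiction refl s₂≢s₃
≢-≢⇒≡-in-pair (inj₂ refl) (inj₁ refl) (inj₂ refl) _     _     = refl
≢-≢⇒≡-in-pair (inj₂ refl) (inj₂ refl) _           s₁≢s₂ _     = contradiction refl s₁≢s₂

module _ {n} {G : Graph n} {k} {col : Fin n → Fin k} (proper : IsProper G col) {a b : Fin k}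
         (C : CycleIn G (λ v → col v ≡ a ⊎ col v ≡ b)) (p : Fin (3 + CycleIn.m C)) where
  open ClosedWalk C p

  walk-colour-2-step : ∀ t → col (walk (suc (suc t))) ≡ col (walk t)
  walk-colour-2-step t = sym (≢-≢⇒≡-in-pair (walk-in t) (walk-in (suc t)) (walk-in (suc (suc t)))
    (proper _ _ (walk-adj t)) (proper _ _ (walk-adj (suc t))))

  walk-colour-2-periodic : ∀ q s → col (walk (q + 2 * s)) ≡ col (walk q)
  walk-colour-2-periodic q zero    = cong (col ∘ walk) (+-identityʳ q)
  walk-colour-2-periodic q (suc s) = begin
    col (walk (q + 2 * suc s))         ≡⟨ cong (col ∘ walk) q+2[1+s]≡2+q+2s ⟩
    col (walk (suc (suc (q + 2 * s)))) ≡⟨ walk-colour-2-step (q + 2 * s) ⟩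
    col (walk (q + 2 * s))             ≡⟨ walk-colour-2-periodic q s ⟩
    col (walk q)                       ∎
    where
    open ≡-Reasoning
    q+2[1+s]≡2+q+2s : q + 2 * suc s ≡ suc (suc (q + 2 * s))
    q+2[1+s]≡2+q+2s = trans (cong (q +_) (*-suc 2 s)) (trans (+-suc q _) (cong suc (+-suc q _)))

  -- An odd cycle cannot alternate between two colours.
  cycle-length-even : ∃ λ r → L ≡ 4 + 2 * r
  cycle-length-even with even⊎odd L
  ... | inj₁ (suc (suc r) , L≡) = r , trans L≡ (trans (*-suc 2 (suc r)) (cong (2 +_) (*-suc 2 r)))
  ... | inj₂ (h , L≡1+2h) = contradiction (begin
    col (walk (2 * h))       ≡⟨ walk-colour-2-periodic 0 h ⟩
    col (walk 0)             ≡⟨ cong col walk-periodic ⟨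
    col (walk L)             ≡⟨ cong (col ∘ walk) L≡1+2h ⟩
    col (walk (suc (2 * h))) ∎) (proper _ _ (walk-adj (2 * h)))
    where open ≡-Reasoning

  bichromaticCycle⇒alternatingPath : AlternatingPath G col (CycleIn.x C p)
  bichromaticCycle⇒alternatingPath = record
    { r = r ; x = z ; inj = z-injective ; step = z-step ; avoid = z-avoid
    ; first-adj = subst (λ v → Adj G v (z zero)) walk-start (walk-adj 0)
    ; last-adj = Adj-sym G (subst₂ (Adj G) (sym z-last) (trans (cong walk (sym L≡)) (trans walk-periodic walk-start))
                                   (walk-adj (3 + 2 * r)))
    ; ends-colour = trans (sym (walk-colour-2-periodic 1 (suc r)))
                          (cong (col ∘ walk) (trans (cong suc (*-suc 2 r)) (sym (cong suc (toℕ-fromℕ (2 + 2 * r))))))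
    ; odd-colour = z-odd-colour }
    where
    r : ℕ
    r = proj₁ cycle-length-even
    L≡ : L ≡ 4 + 2 * r
    L≡ = proj₂ cycle-length-even
    z : Fin (3 + 2 * r) → Fin n
    z j = walk (suc (toℕ j))
    inside : ∀ j → suc (toℕ j) < L
    inside j = subst (suc (toℕ j) <_) (sym L≡) (s≤s (toℕ<n j))
    z-injective : Injective _≡_ _≡_ z
    z-injective {i} {j} e = toℕ-injective (suc-injective (walk-injective (inside i) (inside j) e))
    z-step : ∀ j → Adj G (z (inject₁ j)) (z (suc j))
    z-step j = subst (λ t → Adj G (walk (suc t)) (z (suc j))) (sym (toℕ-inject₁ j)) (walk-adj (suc (toℕ j)))
    z-avoid : ∀ j → z j ≢ CycleIn.x C p
    z-avoid j e = 1+n≢0 (walk-injective (inside j) (s≤s z≤n) (trans e (sym walk-start)))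
    z-last : z (fromℕ (2 + 2 * r)) ≡ walk (3 + 2 * r)
    z-last = cong (walk ∘ suc) (toℕ-fromℕ (2 + 2 * r))
    z-odd-colour : ∀ j q → toℕ j ≡ suc (2 * q) → col (z j) ≡ col (CycleIn.x C p)
    z-odd-colour j q e = begin
      col (walk (suc (toℕ j)))  ≡⟨ cong (col ∘ walk) (trans (cong suc e) (sym (*-suc 2 q))) ⟩
      col (walk (0 + 2 * suc q)) ≡⟨ walk-colour-2-periodic 0 (suc q) ⟩
      col (walk 0)              ≡⟨ cong col walk-start ⟩
      col (CycleIn.x C p)       ∎
      where open ≡-Reasoning

¬acyclic⇒¬¬alternatingPath : ∀ {n} {G : Graph n} {k} {col col′ : Fin n → Fin k} {u} →
  IsProper G col′ → IsAcyclic G col → (∀ w → w ≢ u → col′ w ≡ col w) → ¬ IsAcyclic G col′ →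
  ¬ ¬ AlternatingPath G col′ u
¬acyclic⇒¬¬alternatingPath {G = G} {col = col} {col′} {u} proper′ acyclic agree notAcyclic noPath =
  notAcyclic λ a b C → cycle-through-u? C (any? λ p → CycleIn.x C p ≟ u)
  where
  cycle-through-u? : ∀ {a b} (C : CycleIn G (λ v → col′ v ≡ a ⊎ col′ v ≡ b)) → Dec (∃ λ p → CycleIn.x C p ≡ u) → ⊥
  cycle-through-u? C (yes (p , xp≡u)) = noPath (subst (AlternatingPath G col′) xp≡u (bichromaticCycle⇒alternatingPath proper′ C p))
  cycle-through-u? {a} {b} C (no avoids) = acyclic a b (CycleIn-transport G C λ j → transfer (λ e → avoids (j , e)) (CycleIn.inS C j))
    where
    transfer : ∀ {w} → w ≢ u → col′ w ≡ a ⊎ col′ w ≡ b → col w ≡ a ⊎ col w ≡ b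
    transfer w≢u (inj₁ e) = inj₁ (trans (sym (agree _ w≢u)) e)
    transfer w≢u (inj₂ e) = inj₂ (trans (sym (agree _ w≢u)) e)

-- Colour classes around a vertex

module ColourPartition {n} (G : Graph n) {k} (c : Fin n → Fin k) (u : Fin n) where

  neighbourOfColour : Fin k → Fin n → Bool
  neighbourOfColour l w = Graph.E G u w ∧ ⌊ c w ≟ l ⌋

  neighbourOfColour-intro : ∀ {l w} → Adj G u w → c w ≡ l → T (neighbourOfColour l w)
  neighbourOfColour-intro uw e = Equivalence.from T-∧ (Equivalence.from T-≡ uw , fromWitness e)

  neighbourOfColour-adj : ∀ {l w} → T (neighbourOfColour l w) → Adj G u w
  neighbourOfColour-adj = Equivalence.to T-≡ ∘ proj₁ ∘ Equivalence.to T-∧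

  neighbourOfColour-colour : ∀ {l w} → T (neighbourOfColour l w) → c w ≡ l
  neighbourOfColour-colour {l} {w} h = toWitness {a? = c w ≟ l} (proj₂ (Equivalence.to T-∧ h))

  multiplicity : Fin k → ℕ
  multiplicity l = count (neighbourOfColour l)

  repeated : Fin k → Bool
  repeated l = 2 ≤ᵇ multiplicity l

  open Enumeration (enumerate repeated) renaming (at to repeatedColour)

  class : Fin k → Fin (suc (count repeated))
  class l with T? (repeated l)
  ... | yes r = suc (index l r)
  ... | no _  = zero

  class-repeatedColour : ∀ t → class (repeatedColour t) ≡ suc t
  class-repeatedColour t with T? (repeated (repeatedColour t))
  ... | yes r  = cong suc (at-injective (at-index _ r))
  ... | no ¬r = contradiction (at-holds t) ¬r

  class-unrepeated : ∀ {l} → ¬ T (repeated l) → class l ≡ zero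
  class-unrepeated {l} ¬r with T? (repeated l)
  ... | yes r = contradiction r ¬r
  ... | no _  = refl

  colourPartition : WeakPartition G u
  colourPartition = record { k = count repeated ; part = class ∘ c ; big = big }
    where
    big : ∀ t → ∃ λ w₁ → ∃ λ w₂ → w₁ ≢ w₂ × Adj G u w₁ × class (c w₁) ≡ suc t × Adj G u w₂ × class (c w₂) ≡ suc t
    big t with 2≤count⇒holds₂ (neighbourOfColour (repeatedColour t)) (≤ᵇ⇒≤ 2 _ (at-holds t))
    ... | w₁ , w₂ , w₁≢w₂ , h₁ , h₂ = w₁ , w₂ , w₁≢w₂
      , neighbourOfColour-adj h₁ , trans (cong class (neighbourOfColour-colour h₁)) (class-repeatedColour t)
      , neighbourOfColour-adj h₂ , trans (cong class (neighbourOfColour-colour h₂)) (class-repeatedColour t)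

  single : Fin k → Bool
  single l = multiplicity l ≡ᵇ 1

  singles≤sizeA0 : count single ≤ sizeA0 G colourPartition
  singles≤sizeA0 = subst (count single ≤_) (sym (foldr-count-tabulate inA0 id))
    (injection⇒≤count inA0 onlyNeighbour onlyNeighbour-injective onlyNeighbour-inA0)
    where
    inA0 : Fin n → Bool
    inA0 w = Graph.E G u w ∧ isZero G (class (c w))
    open Enumeration (enumerate single) renaming (at to singleColour; at-holds to single-holds
                                                 ; at-injective to singleColour-injective)
    hasNeighbour : ∀ t → ∃ λ w → T (neighbourOfColour (singleColour t) w)
    hasNeighbour t = 1≤count⇒holds _ (≤-reflexive (sym (≡ᵇ⇒≡ _ 1 (single-holds t))))
    onlyNeighbour : Fin (count single) → Fin n
    onlyNeighbour = proj₁ ∘ hasNeighbour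
    onlyNeighbour-colour : ∀ t → c (onlyNeighbour t) ≡ singleColour t
    onlyNeighbour-colour t = neighbourOfColour-colour (proj₂ (hasNeighbour t))
    onlyNeighbour-injective : Injective _≡_ _≡_ onlyNeighbour
    onlyNeighbour-injective {s} {t} e =
      singleColour-injective (trans (sym (onlyNeighbour-colour s)) (trans (cong c e) (onlyNeighbour-colour t)))
    onlyNeighbour-inA0 : ∀ t → T (inA0 (onlyNeighbour t))
    onlyNeighbour-inA0 t = Equivalence.from T-∧ (Equivalence.from T-≡ (neighbourOfColour-adj (proj₂ (hasNeighbour t)))
      , subst (T ∘ isZero G {count repeated}) (sym (class-unrepeated unrepeated)) _)
      where
      unrepeated : ¬ T (repeated (c (onlyNeighbour t)))
      unrepeated r = 1+n≰n (subst (2 ≤_) multiplicity≡1 (≤ᵇ⇒≤ 2 _ r))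
        where
        multiplicity≡1 : multiplicity (c (onlyNeighbour t)) ≡ 1
        multiplicity≡1 = trans (cong multiplicity (onlyNeighbour-colour t)) (≡ᵇ⇒≡ _ 1 (single-holds t))

  alternatingPath⇒evenPath : ∀ {col : Fin n → Fin k} → (∀ w → Adj G u w → col w ≡ c w) →
                             AlternatingPath G col u → EvenPath G u colourPartition
  alternatingPath⇒evenPath agree π = record
    { r = r ; x = x ; inj = inj ; step = step ; avoid = avoid ; t = index l l-repeated
    ; first = first-adj , class-l
    ; last = last-adj , trans (cong class ends-colour′) class-l }
    where
    open AlternatingPath π
    end : Fin (3 + 2 * r)
    end = fromℕ (2 + 2 * r)
    l : Fin k
    l = c (x zero)
    ends-colour′ : c (x end) ≡ l
    ends-colour′ = trans (sym (agree _ last-adj)) (trans (sym ends-colour) (agree _ first-adj))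
    ends : Fin 2 → Fin n
    ends zero       = x zero
    ends (suc zero) = x end
    ends-injective : Injective _≡_ _≡_ ends
    ends-injective {zero}     {zero}     _ = refl
    ends-injective {zero}     {suc zero} e with () ← inj e
    ends-injective {suc zero} {zero}     e with () ← inj e
    ends-injective {suc zero} {suc zero} _ = refl
    l-repeated : T (repeated l)
    l-repeated = ≤⇒≤ᵇ (injection⇒≤count (neighbourOfColour l) ends ends-injective λ
      { zero → neighbourOfColour-intro first-adj refl ; (suc zero) → neighbourOfColour-intro last-adj ends-colour′ })
    class-l : class l ≡ suc (index l l-repeated)
    class-l = trans (cong class (sym (at-index l l-repeated))) (class-repeatedColour _)

module _ {n} {G : Graph n} {v} {P : WeakPartition G v} where

  colouredEVIFamily : ∀ {m k} (ps : Fin m → EvenPath G v P) (d : Fin n → Fin k) (j : Fin m → Fin k) →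
    Injective _≡_ _≡_ j → (∀ t w → AtEvenPos G (ps t) w → d w ≡ j t) → EVIFamily G v P m
  colouredEVIFamily ps d j j-injective coloured = ps , λ s t s≢t w ws wt →
    s≢t (j-injective (trans (sym (coloured s w ws)) (coloured t w wt)))

  EVIFamily⇒≤n : ∀ {m} → EVIFamily G v P m → m ≤ n
  EVIFamily⇒≤n {m} (ps , disjoint) = injective⇒≤ {f = second} second-injective
    where
    second : Fin m → Fin n
    second t = EvenPath.x (ps t) (suc zero)
    second-injective : Injective _≡_ _≡_ second
    second-injective {s} {t} e with s ≟ t
    ... | yes s≡t = s≡t
    ... | no s≢t  = contradiction (suc zero , (0 , refl) , sym e) (disjoint s t s≢t _ (suc zero , (0 , refl) , refl))

  ¬¬-elp≥ : ∀ {m} → EVIFamily G v P m → ¬ ¬ (∃ λ e → IsElp G v P e × m ≤ e)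
  ¬¬-elp≥ {m} family = ¬¬-map (λ (e , family-e , maximal) → e , (family-e , maximal) , maximal m family)
    (¬¬-bounded-maximum (EVIFamily G v P) (λ _ → EVIFamily⇒≤n) family)

-- Recolouring a colour class

module Recolouring {n} (G : Graph n) {k} (c : Fin n → Fin (suc k)) (i : Fin (suc k)) where

  Missing : Fin n → Fin (suc k) → Set
  Missing w j = j ≢ i × (∀ x → Adj G w x → c x ≢ j)

  IsPartialRecolouring : (Fin n → Fin (suc k)) → Set
  IsPartialRecolouring cc = ∀ w → (c w ≢ i → cc w ≡ c w) × (c w ≡ i → cc w ≡ i ⊎ Missing w (cc w))

  partial-refl : IsPartialRecolouring c
  partial-refl w = (λ _ → refl) , inj₁

  partial-update : ∀ {cc u j} → IsPartialRecolouring cc → c u ≡ i → Missing u j →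
                   IsPartialRecolouring (updateAt cc u (const j))
  partial-update {cc} {u} {j} P cu missing w with w ≟ u
  ... | yes refl rewrite updateAt-updates u {const j} cc = (λ cu≢i → contradiction cu cu≢i) , (λ _ → inj₂ missing)
  ... | no w≢u   rewrite updateAt-minimal w u {const j} cc w≢u = P w

  partial-still-i : ∀ {cc w} → IsPartialRecolouring cc → cc w ≡ i → c w ≡ i
  partial-still-i {w = w} P ccw with c w ≟ i
  ... | yes cw   = cw
  ... | no cw≢i = contradiction (trans (sym (proj₁ (P w) cw≢i)) ccw) cw≢i

  module _ (proper : IsProper G c) where

    neighbour≢i : ∀ {u w} → c u ≡ i → Adj G u w → c w ≢ i
    neighbour≢i cu uw cw = proper _ _ uw (trans cu (sym cw))

    partial-neighbour : ∀ {cc u w} → IsPartialRecolouring cc → c u ≡ i → Adj G u w → cc w ≡ c w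
    partial-neighbour {w = w} P cu uw = proj₁ (P w) (neighbour≢i cu uw)

    recoloured-≢ : ∀ {cc x y} → IsPartialRecolouring cc → c x ≡ i → Adj G x y → cc x ≢ cc y
    recoloured-≢ {x = x} {y} P cx xy e with proj₂ (P x) cx
    ... | inj₁ ccx≡i        = neighbour≢i cx xy (trans (sym (partial-neighbour P cx xy)) (trans (sym e) ccx≡i))
    ... | inj₂ (_ , avoids) = avoids y xy (trans (sym (partial-neighbour P cx xy)) (sym e))

    partial-proper : ∀ {cc} → IsPartialRecolouring cc → IsProper G cc
    partial-proper P x y xy with c x ≟ i | c y ≟ i
    ... | yes cx   | _        = recoloured-≢ P cx xy
    ... | no _     | yes cy   = recoloured-≢ P cy (Adj-sym G xy) ∘ sym
    ... | no cx≢i | no cy≢i = λ e → proper x y xy (trans (sym (proj₁ (P x) cx≢i)) (trans e (proj₁ (P y) cy≢i)))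

  completeRecolouring⇒step : IsAcyclicColoring G c → (∀ v → c v ≡ i → ¬ IsBVertex G c v) →
    ∀ {cc} → IsPartialRecolouring cc → IsAcyclic G cc → (∀ w → i ≢ cc w) → CanAcyclicStep G c
  completeRecolouring⇒step hc noB {cc} P acyclic complete =
    i , c′ , hc , (noB , c′-unchanged , c′-fresh , c′-colouring) , c′-colouring , c′-acyclic
    where
    c′ : Fin n → Fin k
    c′ w = punchOut (complete w)
    punchIn-c′ : ∀ w → punchIn i (c′ w) ≡ cc w
    punchIn-c′ w = punchIn-punchOut (complete w)
    c′-unchanged : ∀ v (i≢cv : i ≢ c v) → c′ v ≡ punchOut i≢cv
    c′-unchanged v i≢cv = punchOut-cong i (proj₁ (P v) (i≢cv ∘ sym))
    c′-fresh : ∀ v → c v ≡ i → punchIn i (c′ v) ≢ c v × (∀ u → Adj G v u → punchIn i (c′ v) ≢ c u)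
    c′-fresh v cv with proj₂ (P v) cv
    ... | inj₁ ccv≡i = contradiction (sym ccv≡i) (complete v)
    ... | inj₂ (_ , avoids) rewrite punchIn-c′ v =
      (λ e → complete v (sym (trans e cv))) , λ u vu e → avoids u vu (sym e)
    c′-proper : IsProper G c′
    c′-proper x y xy e = partial-proper (proj₁ (proj₁ hc)) P x y xy (punchOut-injective (complete x) (complete y) e)
    c′-onto : ∀ j → ∃ λ v → c′ v ≡ j
    c′-onto j with proj₂ (proj₁ hc) (punchIn i j)
    ... | v , cv = v , trans (punchOut-cong i (trans (proj₁ (P v) cv≢i) cv)) (punchOut-punchIn i)
      where
      cv≢i : c v ≢ i
      cv≢i e = punchInᵢ≢i i j (trans (sym cv) e)
    c′-colouring : IsColoring G c′
    c′-colouring = c′-proper , c′-onto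
    c′-acyclic : IsAcyclic G c′
    c′-acyclic a b C = acyclic (punchIn i a) (punchIn i b) (CycleIn-transport G C λ j → lift (CycleIn.inS C j))
      where
      lift : ∀ {v} → c′ v ≡ a ⊎ c′ v ≡ b → cc v ≡ punchIn i a ⊎ cc v ≡ punchIn i b
      lift {v} (inj₁ e) = inj₁ (trans (sym (punchIn-c′ v)) (cong (punchIn i) e))
      lift {v} (inj₂ e) = inj₂ (trans (sym (punchIn-c′ v)) (cong (punchIn i) e))

  module _ (da : Fin n → ℕ) (hda : ∀ v → IsAcyclicDegree G v (da v)) (hc : IsAcyclicColoring G c) where

    stuck⇒k≤da : ∀ {cc u} → IsPartialRecolouring cc → IsAcyclic G cc → c u ≡ i →
                 (∀ j → Missing u j → ¬ IsAcyclic G (updateAt cc u (const j))) → k ≤ da u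
    -- IsElp asks for a maximum, which exists only classically; k ≤ da u is decidable, so we may argue under ¬ ¬.
    stuck⇒k≤da {cc} {u} P acyclic cu stuck = decidable-stable (k ≤? da u) λ k≰da →
      ¬¬-Π-Fin alternating λ πs → ¬¬-elp≥ (family πs) λ (e , isElp , M≤e) → k≰da (bound e isElp M≤e)
      where
      proper : IsProper G c
      proper = proj₁ (proj₁ hc)
      open ColourPartition G c u
      isI absent : Fin (suc k) → Bool
      isI l = ⌊ l ≟ i ⌋
      absent l = (multiplicity l ≡ᵇ 0) ∧ not (isI l)
      open Enumeration (enumerate absent) renaming (at to absentColour; at-holds to absent-holds)
      M : ℕ
      M = count absent
      absent-missing : ∀ t → Missing u (absentColour t)
      absent-missing t = toWitnessFalse l≢i , λ x ux cx≡l → 1+n≰n (subst (1 ≤_) (≡ᵇ⇒≡ (multiplicity l) 0 unseen)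
        (holds⇒1≤count (neighbourOfColour l) (neighbourOfColour-intro ux cx≡l)))
        where
        l = absentColour t
        unseen : T (multiplicity l ≡ᵇ 0)
        unseen = proj₁ (Equivalence.to (T-∧ {multiplicity l ≡ᵇ 0}) (absent-holds t))
        l≢i : T (not (isI l))
        l≢i = proj₂ (Equivalence.to (T-∧ {multiplicity l ≡ᵇ 0}) (absent-holds t))
      recoloured : Fin M → Fin n → Fin (suc k)
      recoloured t = updateAt cc u (const (absentColour t))
      recoloured-elsewhere : ∀ t {w} → w ≢ u → recoloured t w ≡ cc w
      recoloured-elsewhere t {w} w≢u = updateAt-minimal w u cc w≢u
      alternating : ∀ t → ¬ ¬ AlternatingPath G (recoloured t) u
      alternating t = ¬acyclic⇒¬¬alternatingPath (partial-proper proper (partial-update P cu (absent-missing t)))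
        acyclic (λ _ → recoloured-elsewhere t) (stuck _ (absent-missing t))
      family : (∀ t → AlternatingPath G (recoloured t) u) → EVIFamily G u colourPartition M
      family πs = colouredEVIFamily evenPath cc absentColour at-injective coloured
        where
        evenPath : Fin M → EvenPath G u colourPartition
        evenPath t = alternatingPath⇒evenPath
          (λ w uw → trans (recoloured-elsewhere t (Adj-irrefl G uw ∘ sym)) (partial-neighbour proper P cu uw)) (πs t)
        coloured : ∀ t w → AtEvenPos G (evenPath t) w → cc w ≡ absentColour t
        coloured t w (j , (q , j≡1+2q) , xj≡w) = begin
          cc w               ≡⟨ cong cc xj≡w ⟨
          cc (x j)           ≡⟨ recoloured-elsewhere t (avoid j) ⟨
          recoloured t (x j) ≡⟨ odd-colour j q j≡1+2q ⟩
          recoloured t u     ≡⟨ updateAt-updates u cc ⟩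
          absentColour t     ∎
          where
          open ≡-Reasoning
          open AlternatingPath (πs t)
      classified : ∀ l → T (isI l ∨ absent l ∨ single l ∨ repeated l)
      classified l = cases (multiplicity l) (isI l)
        where
        cases : ∀ m b → T (b ∨ ((m ≡ᵇ 0) ∧ not b) ∨ (m ≡ᵇ 1) ∨ (2 ≤ᵇ m))
        cases _             true  = _
        cases 0             false = _
        cases 1             false = _
        cases (suc (suc m)) false = ≤⇒≤ᵇ {2} {suc (suc m)} (s≤s (s≤s z≤n))
      colours≤ : suc k ≤ suc (M + (count single + count repeated))
      colours≤ = let classes = λ l → isI l ∨ absent l ∨ single l ∨ repeated l in begin
        suc k                                                      ≤⟨ injection⇒≤count classes id id classified ⟩
        count (λ l → isI l ∨ absent l ∨ single l ∨ repeated l)      ≤⟨ count-∨ isI (λ l → absent l ∨ single l ∨ repeated l) ⟩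
        count isI + count (λ l → absent l ∨ single l ∨ repeated l)  ≤⟨ +-mono-≤ isI≤1 (≤-trans (count-∨ absent (λ l → single l ∨ repeated l))
                                                                        (+-monoʳ-≤ M (count-∨ single repeated))) ⟩
        suc (M + (count single + count repeated))                  ∎
        where
        open ≤-Reasoning
        isI≤1 : count isI ≤ 1
        isI≤1 = unique⇒count≤1 isI λ {x} {y} x≡i y≡i → trans (toWitness {a? = x ≟ i} x≡i) (sym (toWitness {a? = y ≟ i} y≡i))
      bound : ∀ e → IsElp G u colourPartition e → M ≤ e → k ≤ da u
      bound e isElp M≤e = s≤s⁻¹ (begin
        suc k                                                   ≤⟨ colours≤ ⟩
        suc (M + (count single + count repeated))               ≤⟨ s≤s (+-mono-≤ M≤e (+-monoˡ-≤ _ singles≤sizeA0)) ⟩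
        suc (e + (sizeA0 G colourPartition + count repeated))   ≡⟨ cong suc (+-comm e _) ⟩
        suc (sizeA0 G colourPartition + count repeated + e)     ≤⟨ s≤s (proj₂ (hda u) colourPartition e isElp) ⟩
        suc (da u)                                              ∎)
        where open ≤-Reasoning

    module _ (light : ∀ w → c w ≡ i → ¬ k ≤ da w) where

      recolourAll : ∀ (L : List (Fin n)) {cc} → IsPartialRecolouring cc → IsAcyclic G cc → (∀ w → cc w ≡ i → w ∈ L) →
                    ¬ ¬ (∃ λ cc′ → IsPartialRecolouring cc′ × IsAcyclic G cc′ × ∀ w → i ≢ cc′ w)
      recolourAll [] {cc} P acyclic pending done = done (cc , P , acyclic , λ w i≡ccw → case (pending w (sym i≡ccw)))
        where
        case : ∀ {w} → w ∈ [] → ⊥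
        case ()
      recolourAll (w ∷ L) {cc} P acyclic pending with cc w ≟ i
      ... | no ccw≢i = recolourAll L P acyclic λ x ccx → ∈-tail (pending x ccx) λ { refl → ccw≢i ccx }
      ... | yes ccw≡i = λ done → ¬¬-excluded-middle {A = ∃ λ j → Missing w j × IsAcyclic G (updateAt cc w (const j))} λ
        { (yes (j , missing , acyclic′)) → recolourAll L (partial-update P cw missing) acyclic′ (pending′ missing) done
        ; (no unavailable) → light w cw (stuck⇒k≤da P acyclic cw λ j missing acyclic′ → unavailable (j , missing , acyclic′)) }
        where
        cw : c w ≡ i
        cw = partial-still-i P ccw≡i
        pending′ : ∀ {j} → Missing w j → ∀ x → updateAt cc w (const j) x ≡ i → x ∈ L
        pending′ {j} (j≢i , _) x e with x ≟ w
        ... | yes refl = contradiction (trans (sym (updateAt-updates w cc)) e) j≢i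
        ... | no x≢w  = ∈-tail (pending x (trans (sym (updateAt-minimal x w cc x≢w)) e)) x≢w

      light⇒¬¬step : ¬ ¬ CanAcyclicStep G c
      light⇒¬¬step = ¬¬-map (λ (cc , P , acyclic , complete) → completeRecolouring⇒step hc noB P acyclic complete)
        (recolourAll (allFin n) partial-refl (proj₂ hc) (λ w _ → ∈-allFin w))
        where
        noB : ∀ v → c v ≡ i → ¬ IsBVertex G c v
        noB v cv bv = light v cv (stuck⇒k≤da partial-refl (proj₂ hc) cv λ j missing _ → seen j missing (bv j))
          where
          seen : ∀ j → Missing v j → ¬ (c v ≡ j ⊎ ∃ λ x → Adj G v x × c x ≡ j)
          seen j (j≢i , _)    (inj₁ cv≡j)             = j≢i (trans (sym cv≡j) cv)
          seen j (_ , avoids) (inj₂ (x , vx , cx≡j)) = avoids x vx cx≡j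

heavyVertex : ∀ {n} (G : Graph n) (da : Fin n → ℕ) → (∀ v → IsAcyclicDegree G v (da v)) →
  ∀ {k} (c : Fin n → Fin (suc k)) → IsAcyclicColoring G c → ¬ CanAcyclicStep G c →
  ∀ i → ∃ λ w → c w ≡ i × k ≤ da w
heavyVertex G da hda {k} c hc noStep i = decidable-stable (any? λ w → (c w ≟ i) ×-dec (k ≤? da w)) λ noHeavy →
  Recolouring.light⇒¬¬step G c i da hda hc (λ w cw k≤da → noHeavy (w , cw , k≤da)) noStep

-- Reading off m_a

injective⇒surjective : ∀ {n} {σ : Fin n → Fin n} → Injective _≡_ _≡_ σ → ∀ w → ∃ λ p → σ p ≡ w
injective⇒surjective {suc n} {σ} σ-injective w with any? (λ p → σ p ≟ w)
... | yes hit  = hit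
... | no ¬hit = contradiction (injective⇒≤ {f = squeeze} squeeze-injective) 1+n≰n
  where
  squeeze : Fin (suc n) → Fin n
  squeeze p = punchOut {i = w} λ w≡σp → ¬hit (p , sym w≡σp)
  squeeze-injective : Injective _≡_ _≡_ squeeze
  squeeze-injective e = σ-injective (punchOut-injective {i = w} _ _ e)

∈⇒≤foldr-⊔ : ∀ {x xs} → x ∈ xs → x ≤ foldr _⊔_ 0 xs
∈⇒≤foldr-⊔ {xs = y ∷ ys} (here refl)  = m≤m⊔n y _
∈⇒≤foldr-⊔ {xs = y ∷ ys} (there x∈ys) = ≤-trans (∈⇒≤foldr-⊔ x∈ys) (m≤n⊔m y _)

maFromList-≥ : ∀ {n} (f : Fin n → ℕ) j → toℕ j ≤ f j → suc (toℕ j) ≤ maFromList f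
maFromList-≥ {n} f j j≤fj = subst (_≤ maFromList f) (if-true (≤⇒≤ᵇ j≤fj)) (∈⇒≤foldr-⊔ (∈-map⁺ entry (∈-allFin j)))
  where
  entry : Fin n → ℕ
  entry j = if toℕ j ≤ᵇ f j then suc (toℕ j) else 0
  if-true : ∀ {b} → T b → (if b then suc (toℕ j) else 0) ≡ suc (toℕ j)
  if-true {true} _ = refl

≤maFromList : ∀ {n} {f : Fin n → ℕ} → NonIncreasing f → ∀ {k} (g : Fin (suc k) → Fin n) →
  Injective _≡_ _≡_ g → (∀ t → k ≤ f (g t)) → suc k ≤ maFromList f
≤maFromList {n} {f} nonIncreasing {k} g g-injective k≤fg =
  subst (λ m → suc m ≤ maFromList f) (toℕ-fromℕ< k<n) (maFromList-≥ f kth (subst (_≤ f kth) (sym (toℕ-fromℕ< k<n)) k≤f[k]))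
  where
  k<n : k < n
  k<n = injective⇒≤ g-injective
  kth : Fin n
  kth = fromℕ< k<n
  k≤f[k] : k ≤ f kth
  -- Otherwise the k+1 indices g t would all lie before position k.
  k≤f[k] = decidable-stable (k ≤? f kth) λ k≰f[k] →
    let before : ∀ t → toℕ (g t) < k
        before t = subst (toℕ (g t) <_) (toℕ-fromℕ< k<n) (≰⇒> λ kth≤gt → k≰f[k] (≤-trans (k≤fg t) (nonIncreasing kth (g t) kth≤gt)))
    in 1+n≰n (injective⇒≤ {f = λ t → fromℕ< (before t)} λ e →
         g-injective (toℕ-injective (trans (sym (toℕ-fromℕ< _)) (trans (cong toℕ e) (toℕ-fromℕ< _)))))

theorem2 : ∀ {n} (G : Graph n) (da : Fin n → ℕ) → (∀ v → IsAcyclicDegree G v (da v))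
    → (σ : Fin n → Fin n) → Injective _≡_ _≡_ σ → NonIncreasing (da ∘ σ)
    → ∀ {k} (c : Fin n → Fin k) → IsAcyclicColoring G c → ¬ CanAcyclicStep G c
    → k ≤ maFromList (da ∘ σ)
theorem2 G da hda σ σ-injective nonIncreasing {zero}  c hc noStep = z≤n
theorem2 {n} G da hda σ σ-injective nonIncreasing {suc k} c hc noStep =
  ≤maFromList nonIncreasing rank rank-injective λ t → subst (λ w → k ≤ da w) (sym (σ-rank t)) (heavy-≥ t)
  where
  heavy : ∀ t → ∃ λ w → c w ≡ t × k ≤ da w
  heavy = heavyVertex G da hda c hc noStep
  heavy-colour : ∀ t → c (proj₁ (heavy t)) ≡ t
  heavy-colour t = proj₁ (proj₂ (heavy t))
  heavy-≥ : ∀ t → k ≤ da (proj₁ (heavy t))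
  heavy-≥ t = proj₂ (proj₂ (heavy t))
  rank : Fin (suc k) → Fin n
  rank t = proj₁ (injective⇒surjective σ-injective (proj₁ (heavy t)))
  σ-rank : ∀ t → σ (rank t) ≡ proj₁ (heavy t)
  σ-rank t = proj₂ (injective⇒surjective σ-injective (proj₁ (heavy t)))
  rank-injective : Injective _≡_ _≡_ rank
  rank-injective {s} {t} e = trans (sym (heavy-colour s))
    (trans (cong c (trans (sym (σ-rank s)) (trans (cong σ e) (σ-rank t)))) (heavy-colour t))
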